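{- Let $\mathcal{C},\mathcal{C}'$ be binary linear codes of lengths $n,n'\ge7$ such that (A1$'$) no codeword of $\mathcal{C}$ or $\mathcal{C}^\perp$ has the form $0\cdots0\,x$ with $x$ a length-3 word of Hamming weight 1 or 2; (A2$'$) no codeword of $\mathcal{C}'$ or $\mathcal{C}'^\perp$ has the form $x\,0\cdots0$ with $x$ a length-3 word of Hamming weight 1 or 2; (A3$'$) $0\cdots0111\in\mathcal{C}^\perp$ and $1110\cdots0\in\mathcal{C}'^\perp$. Then $\dim(\mathcal{C}\,\overline{\oplus}_3\,\mathcal{C}')=\dim(\mathcal{C})+\dim(\mathcal{C}')-2$.
   Context: $\mathcal{C}\,\overline{\oplus}_3\,\mathcal{C}'=\overline{\mathcal{C}}\oplus_3\overline{\mathcal{C}'}$, where $\overline{\mathcal{C}}=\mathcal{C}\cup(0\cdots0111+\mathcal{C})$, $\overline{\mathcal{C}'}=\mathcal{C}'\cup(1110\cdots0+\mathcal{C}')$, and for codes $\mathcal{D},\mathcal{D}'$ of lengths $m,m'$ the 3-sum is $\mathcal{D}\oplus_3\mathcal{D}'=\{(d_1,\dots,d_{m-3},d'_4,\dots,d'_{m'}): d\in\mathcal{D},d'\in\mathcal{D}',(d_{m-2},d_{m-1},d_m)=(d'_1,d'_2,d'_3)\}$. -}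

module Defs where

open import Data.Bool using (Bool; true; false; _xor_; _∧_; if_then_else_)
open import Data.Nat using (ℕ; zero; suc; _+_; _≤_)
open import Data.Vec using (Vec; []; _∷_; replicate; zipWith; foldr; _++_; count)
open import Data.Product using (Σ; _×_; Σ-syntax)
open import Data.Sum using (_⊎_)
open import Relation.Binary.PropositionalEquality using (_≡_)
open import Relation.Nullary using (¬_)

-- Binary words of length n (vectors over GF(2), with false = 0, true = 1)
Word : ℕ → Set
Word n = Vec Bool n

zeroW : ∀ n → Word n
zeroW n = replicate n false

infixl 6 _⊕_
_⊕_ : ∀ {n} → Word n → Word n → Word n
_⊕_ = zipWith _xor_

_·_ : ∀ {n} → Word n → Word n → Bool
x · y = foldr _ _xor_ false (zipWith _∧_ x y)

wt : ∀ {n} → Word n → ℕ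
wt {n} x = count (λ b → Data.Bool._≟_ b true) x
  where import Data.Bool

Code : ℕ → Set₁
Code n = Word n → Set

record IsLinear {n} (C : Code n) : Set where
  field
    has-zero : C (zeroW n)
    closed-⊕ : ∀ {x y} → C x → C y → C (x ⊕ y)

Dual : ∀ {n} → Code n → Code n
Dual {n} C y = ∀ c → C c → c · y ≡ false

lincomb : ∀ {n k} → Vec Bool k → Vec (Word n) k → Word n
lincomb {n} [] [] = zeroW n
lincomb (c ∷ cs) (b ∷ bs) = (if c then b else zeroW _) ⊕ lincomb cs bs

AllIn : ∀ {n k} → Code n → Vec (Word n) k → Set
AllIn C [] = Data.Unit.⊤ where import Data.Unit
AllIn C (b ∷ bs) = C b × AllIn C bs

record IsBasis {n k} (C : Code n) (bs : Vec (Word n) k) : Set where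
  field
    inC         : AllIn C bs
    independent : ∀ cs → lincomb cs bs ≡ zeroW n → cs ≡ replicate k false
    spanning    : ∀ w → C w → Σ[ cs ∈ Vec Bool k ] lincomb cs bs ≡ w

HasDim : ∀ {n} → Code n → ℕ → Set
HasDim {n} C k = Σ[ bs ∈ Vec (Word n) k ] IsBasis C bs

ones3 : Word 3
ones3 = true ∷ true ∷ true ∷ []

e-end : ∀ m → Word (m + 3)
e-end m = zeroW m ++ ones3

e-start : ∀ m → Word (3 + m)
e-start m = ones3 ++ zeroW m

barEnd : ∀ {m} → Code (m + 3) → Code (m + 3)
barEnd {m} C w = C w ⊎ (Σ[ c ∈ Word (m + 3) ] C c × w ≡ e-end m ⊕ c)

barStart : ∀ {m} → Code (3 + m) → Code (3 + m)
barStart {m} C w = C w ⊎ (Σ[ c ∈ Word (3 + m) ] C c × w ≡ e-start m ⊕ c)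

sum3 : ∀ {m m'} → Code (m + 3) → Code (3 + m') → Code (m + m')
sum3 {m} {m'} D D' w =
  Σ[ u ∈ Word m ] Σ[ x ∈ Word 3 ] Σ[ v ∈ Word m' ]
    (D (u ++ x) × D' (x ++ v) × w ≡ u ++ v)

barSum3 : ∀ {m m'} → Code (m + 3) → Code (3 + m') → Code (m + m')
barSum3 C C' = sum3 (barEnd C) (barStart C')

Wt12 : Word 3 → Set
Wt12 x = 1 ≤ wt x × wt x ≤ 2

A1 : ∀ {m} → Code (m + 3) → Set
A1 {m} C = ∀ x → Wt12 x → ¬ C (zeroW m ++ x) × ¬ Dual C (zeroW m ++ x)

A2 : ∀ {m} → Code (3 + m) → Set
A2 {m} C = ∀ x → Wt12 x → ¬ C (x ++ zeroW m) × ¬ Dual C (x ++ zeroW m)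

-- Split codewords of C and C' as u x and y v with x, y of length 3; by (A3') x and y have even
-- weight. In the direct sum C ⊞ C' (dimension dim C + dim C') impose x₁ = y₁ and x₂ = y₂, which
-- for even words forces x = y. Each condition lowers the dimension by exactly one, because the dual
-- half of (A1') makes the tails x of C range over all even words. Deleting the middle blocks is
-- injective on the resulting subcode (a codeword 0⋯0x of C with x even is 0 by (A1')) and maps it
-- onto C ⊕̄₃ C': a word of C̄ ⊕₃ C̄' glues C to C' or the two 111-translates to each other, since x
-- and x + 111 are never both even.

module Submission where

open import Defs
open import Algebra.Bundles using (CommutativeRing)
open import Data.Bool using (Bool; true; false; _xor_; _∧_; if_then_else_)
open import Data.Bool.Properties
  using (xor-assoc; xor-same; xor-identityʳ; ∧-distribʳ-xor; ∧-identityʳ; ∧-zeroʳ; xor-∧-commutativeRing)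
open import Algebra.Properties.CommutativeSemigroup
  (CommutativeRing.+-commutativeSemigroup xor-∧-commutativeRing) using (interchange)
open import Data.Nat using (ℕ; zero; suc; _+_; _≤_; z≤n; s≤s)
open import Data.Nat.Properties using (+-comm)
open import Data.Vec using (Vec; []; _∷_; replicate; _++_; map; take; drop; splitAt; tail)
open import Data.Vec.Properties
  using (zipWith-assoc; zipWith-identityˡ; zipWith-identityʳ; zipWith-++; take-zipWith; drop-zipWith;
         take++drop≡id; ++-injectiveˡ; ++-injectiveʳ; ++-injective)
open import Data.Product using (_×_; Σ-syntax; _,_; proj₁; proj₂)
open import Data.Sum using (_⊎_; inj₁; inj₂)
open import Data.Unit using (⊤; tt)
open import Function using (id; _∘_)
open import Relation.Nullary using (¬_; contradiction)
open import Relation.Binary.PropositionalEquality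
open ≡-Reasoning
open IsLinear
open IsBasis

⊕-assoc : ∀ {n} (x y z : Word n) → (x ⊕ y) ⊕ z ≡ x ⊕ (y ⊕ z)
⊕-assoc = zipWith-assoc xor-assoc

⊕-identityˡ : ∀ {n} (x : Word n) → zeroW n ⊕ x ≡ x
⊕-identityˡ = zipWith-identityˡ (λ _ → refl)

⊕-identityʳ : ∀ {n} (x : Word n) → x ⊕ zeroW n ≡ x
⊕-identityʳ = zipWith-identityʳ xor-identityʳ

⊕-same : ∀ {n} (x : Word n) → x ⊕ x ≡ zeroW n
⊕-same []      = refl
⊕-same (a ∷ x) = cong₂ _∷_ (xor-same a) (⊕-same x)

⊕-interchange : ∀ {n} (w x y z : Word n) → (w ⊕ x) ⊕ (y ⊕ z) ≡ (w ⊕ y) ⊕ (x ⊕ z)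
⊕-interchange []      []      []      []      = refl
⊕-interchange (a ∷ w) (b ∷ x) (c ∷ y) (d ∷ z) =
  cong₂ _∷_ (interchange a b c d) (⊕-interchange w x y z)

x⊕y≡z⇒y≡x⊕z : ∀ {n} (x y z : Word n) → x ⊕ y ≡ z → y ≡ x ⊕ z
x⊕y≡z⇒y≡x⊕z x y z x⊕y≡z = begin
  y            ≡⟨ ⊕-identityˡ y ⟨
  zeroW _ ⊕ y  ≡⟨ cong (_⊕ y) (⊕-same x) ⟨
  (x ⊕ x) ⊕ y  ≡⟨ ⊕-assoc x x y ⟩
  x ⊕ (x ⊕ y)  ≡⟨ cong (x ⊕_) x⊕y≡z ⟩
  x ⊕ z        ∎

x⊕y≡0⇒x≡y : ∀ {n} (x y : Word n) → x ⊕ y ≡ zeroW n → x ≡ y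
x⊕y≡0⇒x≡y x y x⊕y≡0 = sym (trans (x⊕y≡z⇒y≡x⊕z x y _ x⊕y≡0) (⊕-identityʳ x))

zeroW-++ : ∀ m n → zeroW (m + n) ≡ zeroW m ++ zeroW n
zeroW-++ zero    n = refl
zeroW-++ (suc m) n = cong (false ∷_) (zeroW-++ m n)

xor≡false⇒≡ : ∀ a b → a xor b ≡ false → a ≡ b
xor≡false⇒≡ false b    b≡false = sym b≡false
xor≡false⇒≡ true false ()
xor≡false⇒≡ true true  _ = refl

·-distribʳ-⊕ : ∀ {n} (x y a : Word n) → (x ⊕ y) · a ≡ (x · a) xor (y · a)
·-distribʳ-⊕ []      []      []      = refl
·-distribʳ-⊕ (p ∷ x) (q ∷ y) (r ∷ a) = begin
  ((p xor q) ∧ r) xor ((x ⊕ y) · a)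
    ≡⟨ cong₂ _xor_ (∧-distribʳ-xor r p q) (·-distribʳ-⊕ x y a) ⟩
  ((p ∧ r) xor (q ∧ r)) xor ((x · a) xor (y · a))
    ≡⟨ interchange (p ∧ r) (q ∧ r) (x · a) (y · a) ⟩
  ((p ∧ r) xor (x · a)) xor ((q ∧ r) xor (y · a))
    ∎

·-zeroˡ : ∀ {n} (a : Word n) → zeroW n · a ≡ false
·-zeroˡ []      = refl
·-zeroˡ (_ ∷ a) = ·-zeroˡ a

·-zeroʳ : ∀ {n} (x : Word n) → x · zeroW n ≡ false
·-zeroʳ []      = refl
·-zeroʳ (p ∷ x) = cong₂ _xor_ (∧-zeroʳ p) (·-zeroʳ x)

·-++ : ∀ {m n} (u v : Word m) (x y : Word n) → (u ++ x) · (v ++ y) ≡ (u · v) xor (x · y)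
·-++ []      []      x y = refl
·-++ (p ∷ u) (q ∷ v) x y =
  trans (cong ((p ∧ q) xor_) (·-++ u v x y)) (sym (xor-assoc (p ∧ q) (u · v) (x · y)))

take-++ : ∀ {A : Set} {m n} (xs : Vec A m) (ys : Vec A n) → take m (xs ++ ys) ≡ xs
take-++ {m = m} xs ys = ++-injectiveˡ (take m (xs ++ ys)) xs (take++drop≡id m (xs ++ ys))

drop-++ : ∀ {A : Set} {m n} (xs : Vec A m) (ys : Vec A n) → drop m (xs ++ ys) ≡ ys
drop-++ {m = m} xs ys = ++-injectiveʳ (take m (xs ++ ys)) xs (take++drop≡id m (xs ++ ys))

dropMiddle : ∀ {A : Set} a b c d → Vec A ((a + b) + (c + d)) → Vec A (a + d)
dropMiddle a b c d w = take a (take (a + b) w) ++ drop c (drop (a + b) w)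

dropMiddle-++ : ∀ {A : Set} {a b c d} (u : Vec A a) (x : Vec A b) (y : Vec A c) (v : Vec A d) →
                dropMiddle a b c d ((u ++ x) ++ (y ++ v)) ≡ u ++ v
dropMiddle-++ u x y v = cong₂ _++_
  (trans (cong (take _) (take-++ (u ++ x) (y ++ v))) (take-++ u x))
  (trans (cong (drop _) (drop-++ (u ++ x) (y ++ v))) (drop-++ y v))

Additive : ∀ {n p} → (Word n → Word p) → Set
Additive f = ∀ x y → f (x ⊕ y) ≡ f x ⊕ f y

Additive⇒zero : ∀ {n p} {f : Word n → Word p} → Additive f → f (zeroW n) ≡ zeroW p
Additive⇒zero {n} {f = f} f-additive = begin
  f (zeroW n)                ≡⟨ cong f (⊕-same (zeroW n)) ⟨
  f (zeroW n ⊕ zeroW n)      ≡⟨ f-additive _ _ ⟩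
  f (zeroW n) ⊕ f (zeroW n)  ≡⟨ ⊕-same _ ⟩
  zeroW _                    ∎

dropMiddle-additive : ∀ a b c d → Additive (dropMiddle a b c d)
dropMiddle-additive a b c d x y = trans
  (cong₂ _++_
    (trans (cong (take a) (take-zipWith {m = a + b} _xor_ x y)) (take-zipWith {m = a} _xor_ _ _))
    (trans (cong (drop c) (drop-zipWith {m = a + b} _xor_ x y)) (drop-zipWith {m = c} _xor_ _ _)))
  (sym (zipWith-++ _xor_ (take a (take (a + b) x)) (drop c (drop (a + b) x))
                         (take a (take (a + b) y)) (drop c (drop (a + b) y))))

Orth : ∀ {n} → Word n → Code n
Orth a w = w · a ≡ false

Full : ∀ n → Code n
Full _ _ = ⊤

infixl 7 _∩_
_∩_ : ∀ {n} → Code n → Code n → Code n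
(D ∩ E) w = D w × E w

_⊞_ : ∀ {m n} → Code m → Code n → Code (m + n)
(D ⊞ E) w = Σ[ u ∈ Word _ ] Σ[ v ∈ Word _ ] D u × E v × w ≡ u ++ v

Full-isLinear : ∀ {n} → IsLinear (Full n)
Full-isLinear = record { has-zero = tt ; closed-⊕ = λ _ _ → tt }

Orth-isLinear : ∀ {n} (a : Word n) → IsLinear (Orth a)
Orth-isLinear a = record
  { has-zero = ·-zeroˡ a
  ; closed-⊕ = λ {x} {y} x⊥a y⊥a → trans (·-distribʳ-⊕ x y a) (cong₂ _xor_ x⊥a y⊥a) }

∩-isLinear : ∀ {n} {D E : Code n} → IsLinear D → IsLinear E → IsLinear (D ∩ E)
∩-isLinear linD linE = record
  { has-zero = has-zero linD , has-zero linE
  ; closed-⊕ = λ (dx , ex) (dy , ey) → closed-⊕ linD dx dy , closed-⊕ linE ex ey }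

⊞-isLinear : ∀ {m n} {D : Code m} {E : Code n} → IsLinear D → IsLinear E → IsLinear (D ⊞ E)
⊞-isLinear {m} {n} linD linE = record
  { has-zero = zeroW m , zeroW n , has-zero linD , has-zero linE , zeroW-++ m n
  ; closed-⊕ = λ { (u , v , du , ev , refl) (u' , v' , du' , ev' , refl) →
      u ⊕ u' , v ⊕ v' , closed-⊕ linD du du' , closed-⊕ linE ev ev' , zipWith-++ _xor_ u v u' v' } }

if-xor-⊕ : ∀ {n} c d (b : Word n) →
           (if c xor d then b else zeroW n) ≡ (if c then b else zeroW n) ⊕ (if d then b else zeroW n)
if-xor-⊕ false d     b = sym (⊕-identityˡ _)
if-xor-⊕ true  false b = sym (⊕-identityʳ b)
if-xor-⊕ true  true  b = sym (⊕-same b)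

lincomb-⊕ : ∀ {n k} (cs ds : Vec Bool k) (bs : Vec (Word n) k) →
            lincomb (cs ⊕ ds) bs ≡ lincomb cs bs ⊕ lincomb ds bs
lincomb-⊕ []       []       []       = sym (⊕-same _)
lincomb-⊕ (c ∷ cs) (d ∷ ds) (b ∷ bs) = begin
  (if c xor d then b else zeroW _) ⊕ lincomb (cs ⊕ ds) bs
    ≡⟨ cong₂ _⊕_ (if-xor-⊕ c d b) (lincomb-⊕ cs ds bs) ⟩
  ((if c then b else zeroW _) ⊕ (if d then b else zeroW _)) ⊕ (lincomb cs bs ⊕ lincomb ds bs)
    ≡⟨ ⊕-interchange _ _ _ _ ⟩
  ((if c then b else zeroW _) ⊕ lincomb cs bs) ⊕ ((if d then b else zeroW _) ⊕ lincomb ds bs)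
    ∎

lincomb-∈ : ∀ {n k} {D : Code n} → IsLinear D → {bs : Vec (Word n) k} → AllIn D bs →
            ∀ cs → D (lincomb cs bs)
lincomb-∈ linD {[]}     _          []           = has-zero linD
lincomb-∈ linD {b ∷ bs} (db , dbs) (false ∷ cs) = closed-⊕ linD (has-zero linD) (lincomb-∈ linD dbs cs)
lincomb-∈ linD {b ∷ bs} (db , dbs) (true ∷ cs)  = closed-⊕ linD db (lincomb-∈ linD dbs cs)

lincomb-map : ∀ {n p k} {f : Word n → Word p} → Additive f →
              (cs : Vec Bool k) (bs : Vec (Word n) k) → lincomb cs (map f bs) ≡ f (lincomb cs bs)
lincomb-map f-additive []       []       = sym (Additive⇒zero f-additive)
lincomb-map {n} {p} {f = f} f-additive (c ∷ cs) (b ∷ bs) =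
  trans (cong₂ _⊕_ (if-map c) (lincomb-map f-additive cs bs)) (sym (f-additive _ _))
  where
  if-map : ∀ c → (if c then f b else zeroW p) ≡ f (if c then b else zeroW n)
  if-map false = sym (Additive⇒zero f-additive)
  if-map true  = refl

lincomb-++ : ∀ {n k k'} (cs : Vec Bool k) (ds : Vec Bool k') (bs : Vec (Word n) k) bs' →
             lincomb (cs ++ ds) (bs ++ bs') ≡ lincomb cs bs ⊕ lincomb ds bs'
lincomb-++ []       ds []       bs' = sym (⊕-identityˡ _)
lincomb-++ (c ∷ cs) ds (b ∷ bs) bs' =
  trans (cong (_ ⊕_) (lincomb-++ cs ds bs bs')) (sym (⊕-assoc _ _ _))

lincomb-· : ∀ {n k} (cs : Vec Bool k) (bs : Vec (Word n) k) (a : Word n) →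
            lincomb cs bs · a ≡ cs · map (_· a) bs
lincomb-· []       []       a = ·-zeroˡ a
lincomb-· (c ∷ cs) (b ∷ bs) a =
  trans (·-distribʳ-⊕ (if c then b else zeroW _) (lincomb cs bs) a)
        (cong₂ _xor_ (if-· c) (lincomb-· cs bs a))
  where
  if-· : ∀ c → (if c then b else zeroW _) · a ≡ c ∧ (b · a)
  if-· false = ·-zeroˡ a
  if-· true  = refl

AllIn-map : ∀ {n p k} {D : Code n} {S : Code p} {f : Word n → Word p} →
            (∀ {x} → D x → S (f x)) → {bs : Vec (Word n) k} → AllIn D bs → AllIn S (map f bs)
AllIn-map D⇒S {[]}     _          = tt
AllIn-map D⇒S {b ∷ bs} (db , dbs) = D⇒S db , AllIn-map D⇒S dbs

AllIn-++ : ∀ {n k k'} {D : Code n} {bs : Vec (Word n) k} {bs' : Vec (Word n) k'} →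
           AllIn D bs → AllIn D bs' → AllIn D (bs ++ bs')
AllIn-++ {bs = []}     _          dbs' = dbs'
AllIn-++ {bs = b ∷ bs} (db , dbs) dbs' = db , AllIn-++ dbs dbs'

HasDim-image : ∀ {j p k} {D : Code j} {S : Code p} (f : Word j → Word p) →
               IsLinear D → Additive f →
               (∀ x → D x → f x ≡ zeroW p → x ≡ zeroW j) →
               (∀ x → D x → S (f x)) →
               (∀ w → S w → Σ[ x ∈ Word j ] D x × f x ≡ w) →
               HasDim D k → HasDim S k
HasDim-image f linD f-additive f-injective f-into f-onto (bs , B) = map f bs , record
  { inC         = AllIn-map (f-into _) (inC B)
  ; independent = λ cs f[lc]≡0 → independent B cs
      (f-injective _ (lincomb-∈ linD (inC B) cs) (trans (sym (lincomb-map f-additive cs bs)) f[lc]≡0))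
  ; spanning    = λ w sw →
      let x , dx , fx≡w = f-onto w sw
          cs , lc≡x     = spanning B x dx
      in cs , trans (lincomb-map f-additive cs bs) (trans (cong f lc≡x) fx≡w) }

HasDim-resp : ∀ {n k} {D E : Code n} → IsLinear D →
              (∀ w → D w → E w) → (∀ w → E w → D w) → HasDim D k → HasDim E k
HasDim-resp linD D⇒E E⇒D =
  HasDim-image id linD (λ _ _ → refl) (λ _ _ w≡0 → w≡0) D⇒E (λ w ew → w , E⇒D w ew , refl)

⊞-basis : ∀ {m n k k'} → Vec (Word m) k → Vec (Word n) k' → Vec (Word (m + n)) (k + k')
⊞-basis {m} {n} bs bs' = map (_++ zeroW n) bs ++ map (zeroW m ++_) bs'

lincomb-⊞-basis : ∀ {m n k k'} (cs : Vec Bool k) (ds : Vec Bool k')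
                  (bs : Vec (Word m) k) (bs' : Vec (Word n) k') →
                  lincomb (cs ++ ds) (⊞-basis bs bs') ≡ lincomb cs bs ++ lincomb ds bs'
lincomb-⊞-basis {m} {n} cs ds bs bs' = begin
  lincomb (cs ++ ds) (⊞-basis bs bs')
    ≡⟨ lincomb-++ cs ds _ _ ⟩
  lincomb cs (map (_++ zeroW n) bs) ⊕ lincomb ds (map (zeroW m ++_) bs')
    ≡⟨ cong₂ _⊕_ (lincomb-map ++zero-additive cs bs) (lincomb-map zero++-additive ds bs') ⟩
  (lincomb cs bs ++ zeroW n) ⊕ (zeroW m ++ lincomb ds bs')
    ≡⟨ zipWith-++ _xor_ (lincomb cs bs) (zeroW n) (zeroW m) (lincomb ds bs') ⟩
  (lincomb cs bs ⊕ zeroW m) ++ (zeroW n ⊕ lincomb ds bs')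
    ≡⟨ cong₂ _++_ (⊕-identityʳ (lincomb cs bs)) (⊕-identityˡ (lincomb ds bs')) ⟩
  lincomb cs bs ++ lincomb ds bs'
    ∎
  where
  ++zero-additive : Additive (_++ zeroW n)
  ++zero-additive x y = trans (cong ((x ⊕ y) ++_) (sym (⊕-same (zeroW n))))
                              (sym (zipWith-++ _xor_ x (zeroW n) y (zeroW n)))
  zero++-additive : Additive (zeroW m ++_)
  zero++-additive x y = trans (cong (_++ (x ⊕ y)) (sym (⊕-same (zeroW m))))
                              (sym (zipWith-++ _xor_ (zeroW m) x (zeroW m) y))

⊞-HasDim : ∀ {m n k k'} {D : Code m} {E : Code n} → IsLinear D → IsLinear E →
           HasDim D k → HasDim E k' → HasDim (D ⊞ E) (k + k')
⊞-HasDim {m} {n} {k} {k'} {D} {E} linD linE (bs , B) (bs' , B') = ⊞-basis bs bs' , record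
  { inC         = AllIn-++ (AllIn-map (λ du → _ , _ , du , has-zero linE , refl) (inC B))
                           (AllIn-map (λ ev → _ , _ , has-zero linD , ev , refl) (inC B'))
  ; independent = independent-⊞
  ; spanning    = spanning-⊞ }
  where
  independent-⊞ : ∀ es → lincomb es (⊞-basis bs bs') ≡ zeroW (m + n) → es ≡ replicate (k + k') false
  independent-⊞ es lc≡0 with splitAt k es
  ... | cs , ds , refl =
    let cs≡0 , ds≡0 = ++-injective (lincomb cs bs) (zeroW m)
                        (trans (sym (lincomb-⊞-basis cs ds bs bs')) (trans lc≡0 (zeroW-++ m n)))
    in trans (cong₂ _++_ (independent B cs cs≡0) (independent B' ds ds≡0)) (sym (zeroW-++ k k'))
  spanning-⊞ : ∀ w → (D ⊞ E) w → Σ[ es ∈ Vec Bool (k + k') ] lincomb es (⊞-basis bs bs') ≡ w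
  spanning-⊞ _ (u , v , du , ev , refl) =
    let cs , lc≡u = spanning B u du
        ds , lc≡v = spanning B' v ev
    in cs ++ ds , trans (lincomb-⊞-basis cs ds bs bs') (cong₂ _++_ lc≡u lc≡v)

Full₁-HasDim : HasDim (Full 1) 1
Full₁-HasDim = (true ∷ []) ∷ [] , record
  { inC         = tt , tt
  ; independent = λ { (false ∷ []) _ → refl ; (true ∷ []) () }
  ; spanning    = λ { (b ∷ []) _ → b ∷ [] , lincomb-unit b } }
  where
  lincomb-unit : ∀ b → lincomb (b ∷ []) ((true ∷ []) ∷ []) ≡ b ∷ []
  lincomb-unit false = refl
  lincomb-unit true  = refl

Full-HasDim : ∀ n → HasDim (Full n) n
Full-HasDim zero    = [] , record
  { inC = tt ; independent = λ { [] _ → refl } ; spanning = λ { [] _ → [] , refl } }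
Full-HasDim (suc n) =
  HasDim-resp (⊞-isLinear Full-isLinear Full-isLinear) (λ _ _ → tt)
              (λ { (b ∷ w) _ → b ∷ [] , w , tt , tt , refl })
              (⊞-HasDim Full-isLinear Full-isLinear Full₁-HasDim (Full-HasDim n))

Orth-HasDim : ∀ {k} (ψ : Word k) → ψ ≢ zeroW k → Σ[ d ∈ ℕ ] HasDim (Orth ψ) d × suc d ≡ k
Orth-HasDim [] ψ≢0 = contradiction refl ψ≢0
Orth-HasDim {suc k} (true ∷ ψ) _ =
  k , HasDim-image graph Full-isLinear graph-additive graph-injective graph-⊥ graph-onto (Full-HasDim k)
    , refl
  where
  graph : Word k → Word (suc k)
  graph ds = (ds · ψ) ∷ ds
  graph-additive : Additive graph
  graph-additive ds es = cong (_∷ ds ⊕ es) (·-distribʳ-⊕ ds es ψ)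
  graph-injective : ∀ ds → ⊤ → graph ds ≡ zeroW (suc k) → ds ≡ zeroW k
  graph-injective _ _ = cong tail
  graph-⊥ : ∀ ds → ⊤ → Orth (true ∷ ψ) (graph ds)
  graph-⊥ ds _ = trans (cong (_xor (ds · ψ)) (∧-identityʳ (ds · ψ))) (xor-same (ds · ψ))
  graph-onto : ∀ w → Orth (true ∷ ψ) w → Σ[ ds ∈ Word k ] ⊤ × graph ds ≡ w
  graph-onto (w₀ ∷ ds) w⊥ =
    ds , tt , cong (_∷ ds) (sym (xor≡false⇒≡ w₀ (ds · ψ)
                                  (trans (cong (_xor (ds · ψ)) (sym (∧-identityʳ w₀))) w⊥)))
Orth-HasDim (false ∷ ψ) ψ≢0 =
  let d , dimψ , 1+d≡k = Orth-HasDim ψ (ψ≢0 ∘ cong (false ∷_))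
  in suc d , HasDim-resp (⊞-isLinear Full-isLinear (Orth-isLinear ψ)) into onto
                         (⊞-HasDim Full-isLinear (Orth-isLinear ψ) Full₁-HasDim dimψ) , cong suc 1+d≡k
  where
  into : ∀ w → (Full 1 ⊞ Orth ψ) w → Orth (false ∷ ψ) w
  into _ (b ∷ [] , v , _ , v⊥ψ , refl) = trans (cong (_xor (v · ψ)) (∧-zeroʳ b)) v⊥ψ
  onto : ∀ w → Orth (false ∷ ψ) w → (Full 1 ⊞ Orth ψ) w
  onto (b ∷ v) w⊥ = b ∷ [] , v , tt , trans (cong (_xor (v · ψ)) (sym (∧-zeroʳ b))) w⊥ , refl

∩-Orth-HasDim : ∀ {n k} {D : Code n} {a : Word n} → IsLinear D → HasDim D k →
                Σ[ c ∈ Word n ] D c × c · a ≡ true →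
                Σ[ d ∈ ℕ ] HasDim (D ∩ Orth a) d × suc d ≡ k
∩-Orth-HasDim {n} {k} {D} {a} linD (bs , B) (c , dc , c·a≡true) =
  let d , dimψ , 1+d≡k = Orth-HasDim ψ ψ≢0
  in d , HasDim-image (λ cs → lincomb cs bs) (Orth-isLinear ψ) (λ cs ds → lincomb-⊕ cs ds bs)
                      (λ cs _ → independent B cs) into onto dimψ , 1+d≡k
  where
  ψ : Word k
  ψ = map (_· a) bs
  ψ≢0 : ψ ≢ zeroW k
  ψ≢0 ψ≡0 = let cs , lc≡c = spanning B c dc in contradiction (begin
    true                  ≡⟨ c·a≡true ⟨
    c · a                 ≡⟨ cong (_· a) lc≡c ⟨
    lincomb cs bs · a     ≡⟨ lincomb-· cs bs a ⟩
    cs · ψ                ≡⟨ cong (cs ·_) ψ≡0 ⟩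
    cs · zeroW k          ≡⟨ ·-zeroʳ cs ⟩
    false                 ∎) λ ()
  into : ∀ cs → Orth ψ cs → (D ∩ Orth a) (lincomb cs bs)
  into cs cs⊥ψ = lincomb-∈ linD (inC B) cs , trans (lincomb-· cs bs a) cs⊥ψ
  onto : ∀ w → (D ∩ Orth a) w → Σ[ cs ∈ Word k ] Orth ψ cs × lincomb cs bs ≡ w
  onto w (dw , w⊥a) =
    let cs , lc≡w = spanning B w dw
    in cs , trans (sym (lincomb-· cs bs a)) (trans (cong (_· a) lc≡w) w⊥a) , lc≡w

AllIn-Orth-or-witness : ∀ {n k} {D : Code n} (a : Word n) (bs : Vec (Word n) k) → AllIn D bs →
                        AllIn (Orth a) bs ⊎ Σ[ c ∈ Word n ] D c × c · a ≡ true
AllIn-Orth-or-witness a []       _          = inj₁ tt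
AllIn-Orth-or-witness a (b ∷ bs) (db , dbs) with b · a in b·a | AllIn-Orth-or-witness a bs dbs
... | true  | _             = inj₂ (b , db , b·a)
... | false | inj₁ bs⊥a     = inj₁ (refl , bs⊥a)
... | false | inj₂ witness  = inj₂ witness

Dual-or-witness : ∀ {n k} {D : Code n} → HasDim D k → (a : Word n) →
                  Dual D a ⊎ Σ[ c ∈ Word n ] D c × c · a ≡ true
Dual-or-witness (bs , B) a with AllIn-Orth-or-witness a bs (inC B)
... | inj₂ witness = inj₂ witness
... | inj₁ bs⊥a    = inj₁ λ c dc →
  let cs , lc≡c = spanning B c dc in subst (Orth a) lc≡c (lincomb-∈ (Orth-isLinear a) bs⊥a cs)

Even : Word 3 → Set
Even x = x · ones3 ≡ false

e100 e010 e001 e011 : Word 3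
e100 = true  ∷ false ∷ false ∷ []
e010 = false ∷ true  ∷ false ∷ []
e001 = false ∷ false ∷ true  ∷ []
e011 = false ∷ true  ∷ true  ∷ []

data EvenView : Word 3 → Set where
  ⟨000⟩ : EvenView (false ∷ false ∷ false ∷ [])
  ⟨110⟩ : EvenView (true  ∷ true  ∷ false ∷ [])
  ⟨101⟩ : EvenView (true  ∷ false ∷ true  ∷ [])
  ⟨011⟩ : EvenView (false ∷ true  ∷ true  ∷ [])

evenView : ∀ x → Even x → EvenView x
evenView (false ∷ false ∷ false ∷ []) _  = ⟨000⟩
evenView (false ∷ false ∷ true  ∷ []) ()
evenView (false ∷ true  ∷ false ∷ []) ()
evenView (false ∷ true  ∷ true  ∷ []) _  = ⟨011⟩
evenView (true  ∷ false ∷ false ∷ []) ()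
evenView (true  ∷ false ∷ true  ∷ []) _  = ⟨101⟩
evenView (true  ∷ true  ∷ false ∷ []) _  = ⟨110⟩
evenView (true  ∷ true  ∷ true  ∷ []) ()

even⇒zero⊎Wt12 : ∀ {x} → Even x → x ≡ zeroW 3 ⊎ Wt12 x
even⇒zero⊎Wt12 {x} even-x with evenView x even-x
... | ⟨000⟩ = inj₁ refl
... | ⟨110⟩ = inj₂ (s≤s z≤n , s≤s (s≤s z≤n))
... | ⟨101⟩ = inj₂ (s≤s z≤n , s≤s (s≤s z≤n))
... | ⟨011⟩ = inj₂ (s≤s z≤n , s≤s (s≤s z≤n))

even-⊕ : ∀ {x y} → Even x → Even y → Even (x ⊕ y)
even-⊕ {x} {y} even-x even-y = trans (·-distribʳ-⊕ x y ones3) (cong₂ _xor_ even-x even-y)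

even⇒¬even-complement : ∀ {x} → Even x → ¬ Even (ones3 ⊕ x)
even⇒¬even-complement {x} even-x with evenView x even-x
... | ⟨000⟩ = λ ()
... | ⟨110⟩ = λ ()
... | ⟨101⟩ = λ ()
... | ⟨011⟩ = λ ()

even-zero : ∀ {z} → Even z → z · e100 ≡ false → z · e010 ≡ false → z ≡ zeroW 3
even-zero {z} even-z with evenView z even-z
... | ⟨000⟩ = λ _ _ → refl
... | ⟨110⟩ = λ ()
... | ⟨101⟩ = λ ()
... | ⟨011⟩ = λ _ ()

even-≡ : ∀ {x y} → Even x → Even y →
         (x · e100) xor (y · e100) ≡ false → (x · e010) xor (y · e010) ≡ false → x ≡ y
even-≡ {x} {y} even-x even-y agree₁ agree₂ = x⊕y≡0⇒x≡y x y
  (even-zero (even-⊕ {x} {y} even-x even-y)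
             (trans (·-distribʳ-⊕ x y e100) agree₁) (trans (·-distribʳ-⊕ x y e010) agree₂))

evenSubspace-∋-011 : (S : Word 3 → Set) →
                     (∀ {x y} → S x → S y → S (x ⊕ y)) → (∀ {x} → S x → Even x) →
                     (∀ y → Wt12 y → Σ[ x ∈ Word 3 ] S x × x · y ≡ true) → S e011
evenSubspace-∋-011 S closed even probe
  with probe e010 (s≤s z≤n , s≤s z≤n) | probe e001 (s≤s z≤n , s≤s z≤n)
... | s , Ss , s·e010 | t , St , t·e001 with evenView s (even Ss) | evenView t (even St)
... | ⟨011⟩ | _     = Ss
... | _     | ⟨011⟩ = St
... | ⟨110⟩ | ⟨101⟩ = closed Ss St
... | ⟨000⟩ | _     = contradiction s·e010 λ ()
... | ⟨101⟩ | _     = contradiction s·e010 λ ()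
... | ⟨110⟩ | ⟨000⟩ = contradiction t·e001 λ ()
... | ⟨110⟩ | ⟨110⟩ = contradiction t·e001 λ ()

module ThreeSum {m m' : ℕ} (C : Code (m + 3)) (C' : Code (3 + m'))
  (linC : IsLinear C) (linC' : IsLinear C') (noShortC : A1 C)
  (evenC : Dual C (e-end m)) (evenC' : Dual C' (e-start m')) where

  N : ℕ
  N = (m + 3) + (3 + m')

  seam : Word 3 → Word N
  seam p = (zeroW m ++ p) ++ (p ++ zeroW m')

  seam-value : ∀ u x y v p → ((u ++ x) ++ (y ++ v)) · seam p ≡ (x · p) xor (y · p)
  seam-value u x y v p = begin
    ((u ++ x) ++ (y ++ v)) · seam p
      ≡⟨ ·-++ (u ++ x) (zeroW m ++ p) (y ++ v) (p ++ zeroW m') ⟩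
    ((u ++ x) · (zeroW m ++ p)) xor ((y ++ v) · (p ++ zeroW m'))
      ≡⟨ cong₂ _xor_ (·-++ u (zeroW m) x p) (·-++ y p v (zeroW m')) ⟩
    ((u · zeroW m) xor (x · p)) xor ((y · p) xor (v · zeroW m'))
      ≡⟨ cong₂ (λ s t → (s xor (x · p)) xor ((y · p) xor t)) (·-zeroʳ u) (·-zeroʳ v) ⟩
    (x · p) xor ((y · p) xor false)
      ≡⟨ cong ((x · p) xor_) (xor-identityʳ (y · p)) ⟩
    (x · p) xor (y · p)
      ∎

  even-tail : ∀ {u x} → C (u ++ x) → Even x
  even-tail {u} {x} cux = begin
    x · ones3                      ≡⟨ cong (_xor (x · ones3)) (·-zeroʳ u) ⟨
    (u · zeroW m) xor (x · ones3)  ≡⟨ ·-++ u (zeroW m) x ones3 ⟨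
    (u ++ x) · e-end m             ≡⟨ evenC _ cux ⟩
    false                          ∎

  even-head : ∀ {x v} → C' (x ++ v) → Even x
  even-head {x} {v} cxv = begin
    x · ones3                       ≡⟨ xor-identityʳ _ ⟨
    (x · ones3) xor false           ≡⟨ cong ((x · ones3) xor_) (·-zeroʳ v) ⟨
    (x · ones3) xor (v · zeroW m')  ≡⟨ ·-++ x ones3 v (zeroW m') ⟨
    (x ++ v) · e-start m'           ≡⟨ evenC' _ cxv ⟩
    false                           ∎

  barEnd-view : ∀ {u x} → barEnd C (u ++ x) → C (u ++ x) ⊎ C (u ++ (ones3 ⊕ x))
  barEnd-view (inj₁ cux) = inj₁ cux
  barEnd-view {u} {x} (inj₂ (c , cc , ux≡e+c)) = inj₂ (subst C (begin
    c                              ≡⟨ x⊕y≡z⇒y≡x⊕z (e-end m) c (u ++ x) (sym ux≡e+c) ⟩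
    (zeroW m ++ ones3) ⊕ (u ++ x)  ≡⟨ zipWith-++ _xor_ (zeroW m) ones3 u x ⟩
    (zeroW m ⊕ u) ++ (ones3 ⊕ x)   ≡⟨ cong (_++ (ones3 ⊕ x)) (⊕-identityˡ u) ⟩
    u ++ (ones3 ⊕ x)               ∎) cc)

  barStart-view : ∀ {x v} → barStart C' (x ++ v) → C' (x ++ v) ⊎ C' ((ones3 ⊕ x) ++ v)
  barStart-view (inj₁ cxv) = inj₁ cxv
  barStart-view {x} {v} (inj₂ (c , cc , xv≡e+c)) = inj₂ (subst C' (begin
    c                               ≡⟨ x⊕y≡z⇒y≡x⊕z (e-start m') c (x ++ v) (sym xv≡e+c) ⟩
    (ones3 ++ zeroW m') ⊕ (x ++ v)  ≡⟨ zipWith-++ _xor_ ones3 (zeroW m') x v ⟩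
    (ones3 ⊕ x) ++ (zeroW m' ⊕ v)   ≡⟨ cong ((ones3 ⊕ x) ++_) (⊕-identityˡ v) ⟩
    (ones3 ⊕ x) ++ v                ∎) cc)

  C⊞C' : Code N
  C⊞C' = C ⊞ C'

  Agree₁ : Code N
  Agree₁ = C⊞C' ∩ Orth (seam e100)

  Glued : Code N
  Glued = Agree₁ ∩ Orth (seam e010)

  C⊞C'-isLinear : IsLinear C⊞C'
  C⊞C'-isLinear = ⊞-isLinear linC linC'

  Agree₁-isLinear : IsLinear Agree₁
  Agree₁-isLinear = ∩-isLinear C⊞C'-isLinear (Orth-isLinear _)

  Glued-isLinear : IsLinear Glued
  Glued-isLinear = ∩-isLinear Agree₁-isLinear (Orth-isLinear _)

  data GluedView : Word N → Set where
    glued : ∀ (u : Word m) (x : Word 3) (v : Word m') →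
            C (u ++ x) → C' (x ++ v) → GluedView ((u ++ x) ++ (x ++ v))

  gluedView : ∀ {w} → Glued w → GluedView w
  gluedView (((c , c' , cc , cc' , refl) , c⊥seam₁) , c⊥seam₂) with splitAt m c | splitAt 3 c'
  ... | u , x , refl | y , v , refl
    with even-≡ {x} {y} (even-tail {u} cc) (even-head {v = v} cc')
                (trans (sym (seam-value u x y v e100)) c⊥seam₁)
                (trans (sym (seam-value u x y v e010)) c⊥seam₂)
  ... | refl = glued u x v cc cc'

  glue : ∀ (u : Word m) (x : Word 3) (v : Word m') →
         C (u ++ x) → C' (x ++ v) → Glued ((u ++ x) ++ (x ++ v))
  glue u x v cux cxv =
    ((u ++ x , x ++ v , cux , cxv , refl) , trans (seam-value u x x v e100) (xor-same (x · e100))) ,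
    trans (seam-value u x x v e010) (xor-same (x · e010))

  squeeze : Word N → Word (m + m')
  squeeze = dropMiddle m 3 3 m'

  squeeze-injective : ∀ w → Glued w → squeeze w ≡ zeroW (m + m') → w ≡ zeroW N
  squeeze-injective w gw squeeze≡0 with gluedView gw
  ... | glued u x v cux cxv
    with ++-injective u (zeroW m) (trans (sym (dropMiddle-++ u x x v)) (trans squeeze≡0 (zeroW-++ m m')))
  ... | refl , refl with even⇒zero⊎Wt12 {x} (even-tail {zeroW m} cux)
  ...   | inj₂ wt12 = contradiction cux (proj₁ (noShortC x wt12))
  ...   | inj₁ refl = sym (trans (zeroW-++ (m + 3) (3 + m')) (cong (_++ zeroW (3 + m')) (zeroW-++ m 3)))

  squeeze-into : ∀ w → Glued w → barSum3 C C' (squeeze w)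
  squeeze-into w gw with gluedView gw
  ... | glued u x v cux cxv = u , x , v , inj₁ cux , inj₁ cxv , dropMiddle-++ u x x v

  squeeze-onto : ∀ w → barSum3 C C' w → Σ[ z ∈ Word N ] Glued z × squeeze z ≡ w
  squeeze-onto _ (u , x , v , c̄ux , c̄'xv , refl) with barEnd-view {u} {x} c̄ux | barStart-view {x} {v} c̄'xv
  ... | inj₁ cux | inj₁ cxv = _ , glue u x v cux cxv , dropMiddle-++ u x x v
  ... | inj₂ cux̄ | inj₂ cx̄v = _ , glue u x̄ v cux̄ cx̄v , dropMiddle-++ u x̄ x̄ v
    where x̄ = ones3 ⊕ x
  ... | inj₁ cux | inj₂ cx̄v =
    contradiction (even-head {ones3 ⊕ x} {v} cx̄v) (even⇒¬even-complement {x} (even-tail {u} cux))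
  ... | inj₂ cux̄ | inj₁ cxv =
    contradiction (even-tail {u} {ones3 ⊕ x} cux̄) (even⇒¬even-complement {x} (even-head {v = v} cxv))

  Tail : Word 3 → Set
  Tail x = Σ[ u ∈ Word m ] C (u ++ x)

  Tail-closed : ∀ {x y} → Tail x → Tail y → Tail (x ⊕ y)
  Tail-closed {x} {y} (u , cux) (u' , cu'y) =
    u ⊕ u' , subst C (zipWith-++ _xor_ u x u' y) (closed-⊕ linC cux cu'y)

  tail-probe : ∀ {k} → HasDim C k → ∀ y → Wt12 y → Σ[ x ∈ Word 3 ] Tail x × x · y ≡ true
  tail-probe dimC y wt12 with Dual-or-witness dimC (zeroW m ++ y)
  ... | inj₁ y∈C⊥ = contradiction y∈C⊥ (proj₂ (noShortC y wt12))
  ... | inj₂ (c , cc , c·y≡true) with splitAt m c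
  ...   | u , x , refl =
    x , (u , cc) , trans (sym (trans (·-++ u (zeroW m) x y) (cong (_xor (x · y)) (·-zeroʳ u)))) c·y≡true

  witness₁ : ∀ {k} → HasDim C k → Σ[ w ∈ Word N ] C⊞C' w × w · seam e100 ≡ true
  witness₁ dimC =
    let x , (u , cux) , x·e100≡true = tail-probe dimC e100 (s≤s z≤n , s≤s z≤n)
    in (u ++ x) ++ zeroW (3 + m') ,
       (u ++ x , zeroW (3 + m') , cux , has-zero linC' , refl) ,
       trans (seam-value u x (zeroW 3) (zeroW m') e100) (trans (xor-identityʳ (x · e100)) x·e100≡true)

  witness₂ : ∀ {k} → HasDim C k → Σ[ w ∈ Word N ] Agree₁ w × w · seam e010 ≡ true
  witness₂ dimC =
    let u , cu011 = evenSubspace-∋-011 Tail Tail-closed (λ (u , cux) → even-tail {u} cux) (tail-probe dimC)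
    in (u ++ e011) ++ zeroW (3 + m') ,
       ((u ++ e011 , zeroW (3 + m') , cu011 , has-zero linC' , refl) ,
        seam-value u e011 (zeroW 3) (zeroW m') e100) ,
       seam-value u e011 (zeroW 3) (zeroW m') e010

lemma4p14 : (m m' : ℕ) → 4 ≤ m → 4 ≤ m'
    → (C : Code (m + 3)) (C' : Code (3 + m'))
    → IsLinear C → IsLinear C'
    → A1 C → A2 C'
    → Dual C (e-end m) → Dual C' (e-start m')
    → (k k' : ℕ) → HasDim C k → HasDim C' k'
    → Σ[ d ∈ ℕ ] (HasDim (barSum3 C C') d × d + 2 ≡ k + k')
lemma4p14 m m' _ _ C C' linC linC' noShortC _ evenC evenC' k k' dimC dimC' =
  let d₁ , dim₁ , 1+d₁≡k+k' = ∩-Orth-HasDim C⊞C'-isLinear (⊞-HasDim linC linC' dimC dimC') (witness₁ dimC)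
      d₂ , dim₂ , 1+d₂≡d₁   = ∩-Orth-HasDim Agree₁-isLinear dim₁ (witness₂ dimC)
  in d₂ ,
     HasDim-image squeeze Glued-isLinear (dropMiddle-additive m 3 3 m')
                  squeeze-injective squeeze-into squeeze-onto dim₂ ,
     trans (+-comm d₂ 2) (trans (cong suc 1+d₂≡d₁) 1+d₁≡k+k')
  where open ThreeSum C C' linC linC' noShortC evenC evenC'
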